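{- For $n\ge 1$ let $\mathbf{x}=(x_1,\dots,x_n)$, $\mathbf{a}=(a_1,\dots,a_n)$, $\mathbf{b}=(b_1,\dots,b_n)$ and let $\psi_n(\mathbf{x},\mathbf{a},\mathbf{b})$ be the CNF consisting of the clauses $\neg a_i\vee\neg x_i\vee x_{i+1}$, $\neg a_i\vee x_i\vee\neg x_{i+1}$, $\neg b_i\vee\neg x_i\vee x_{i+1}$, $\neg b_i\vee x_i\vee\neg x_{i+1}$ for $i=1,\dots,n-1$, together with $\neg a_n\vee\neg x_1\vee\neg x_n$, $\neg a_n\vee x_1\vee x_n$, $\neg b_n\vee\neg x_1\vee\neg x_n$, $\neg b_n\vee x_1\vee x_n$. (Equivalently, $\psi_n\equiv\bigwedge_{i=1}^{n-1}[(a_i\vee b_i)\Rightarrow(x_i\Leftrightarrow x_{i+1})]\wedge[(a_n\vee b_n)\Rightarrow(x_1\Leftrightarrow\neg x_n)]$.) If $\varphi$ is a URC formula equivalent to $\psi_n$, then $|\varphi|\ge 2^n$.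
   Context: $|\varphi|$ is the number of clauses of the CNF $\varphi$. A partial assignment is a set of literals with no complementary pair, identified with their conjunction. Unit resolution derives $C\setminus\{l\}$ from a clause $C\ni l$ and the unit clause $\neg l$; $\vdash_1$ denotes derivability by repeated unit resolution; $\bot$ is the empty clause. A CNF $\varphi(\mathbf{z})$ is URC if for every partial assignment $\alpha$ of $\mathbf{z}$, $\varphi\wedge\alpha\models\bot$ implies $\varphi\wedge\alpha\vdash_1\bot$. "Equivalent" means a CNF on the same variables $\mathbf{x},\mathbf{a},\mathbf{b}$ representing the same function. -}

module Defs where

open import Data.Nat using (ℕ; suc)
open import Data.Fin using (Fin; zero; suc; inject₁; fromℕ)
import Data.Fin as F
open import Data.Bool using (Bool; true; false; not)
open import Data.List using (List; []; _∷_; _++_; map; concatMap; allFin; filter)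
open import Data.Bool.ListAction using (any; all)
open import Data.List.Membership.Propositional using (_∈_; _∉_)
open import Data.List.Relation.Unary.All using (All)
open import Relation.Binary.PropositionalEquality using (_≡_; refl; cong)
open import Relation.Nullary using (Dec; yes; no; ¬_; ¬?)
open import Relation.Nullary.Decidable using (map′)
open import Data.Product using (_×_)

data Var (n : ℕ) : Set where
  x a b : Fin n → Var n

data Lit (n : ℕ) : Set where
  pos neg : Var n → Lit n

compl : ∀ {n} → Lit n → Lit n
compl (pos v) = neg v
compl (neg v) = pos v

_≟V_ : ∀ {n} (u v : Var n) → Dec (u ≡ v)
x i ≟V x j = map′ (cong x) (λ { refl → refl }) (i F.≟ j)
a i ≟V a j = map′ (cong a) (λ { refl → refl }) (i F.≟ j)
b i ≟V b j = map′ (cong b) (λ { refl → refl }) (i F.≟ j)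
x _ ≟V a _ = no λ ()
x _ ≟V b _ = no λ ()
a _ ≟V x _ = no λ ()
a _ ≟V b _ = no λ ()
b _ ≟V x _ = no λ ()
b _ ≟V a _ = no λ ()

_≟L_ : ∀ {n} (l m : Lit n) → Dec (l ≡ m)
pos u ≟L pos v = map′ (cong pos) (λ { refl → refl }) (u ≟V v)
neg u ≟L neg v = map′ (cong neg) (λ { refl → refl }) (u ≟V v)
pos _ ≟L neg _ = no λ ()
neg _ ≟L pos _ = no λ ()

-- A clause is a disjunction of literals (a list read as a set); a CNF is a list of clauses.
Clause : ℕ → Set
Clause n = List (Lit n)

CNF : ℕ → Set
CNF n = List (Clause n)

-- |φ| = number of clauses = length φ

evalLit : ∀ {n} → (Var n → Bool) → Lit n → Bool
evalLit σ (pos v) = σ v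
evalLit σ (neg v) = not (σ v)

evalClause : ∀ {n} → (Var n → Bool) → Clause n → Bool
evalClause σ C = any (evalLit σ) C

evalCNF : ∀ {n} → (Var n → Bool) → CNF n → Bool
evalCNF σ φ = all (evalClause σ) φ

Equivalent : ∀ {n} → CNF n → CNF n → Set
Equivalent φ ψ = ∀ σ → evalCNF σ φ ≡ evalCNF σ ψ

PartialAssignment : ∀ {n} → List (Lit n) → Set
PartialAssignment α = ∀ {l} → l ∈ α → compl l ∉ α

_∧ₚ_ : ∀ {n} → CNF n → List (Lit n) → CNF n
φ ∧ₚ α = φ ++ map (λ l → l ∷ []) α

Unsat : ∀ {n} → CNF n → Set
Unsat φ = ∀ σ → evalCNF σ φ ≡ false

remove : ∀ {n} → Lit n → Clause n → Clause n
remove l C = filter (λ m → ¬? (m ≟L l)) C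

-- Derivability by repeated unit resolution: from C ∋ l and the unit clause ¬l
-- (a clause all of whose literals are ¬l) derive C \ {l}.
data _⊢₁_ {n} (φ : CNF n) : Clause n → Set where
  axiom    : ∀ {C} → C ∈ φ → φ ⊢₁ C
  unit-res : ∀ {C l D} → φ ⊢₁ C → l ∈ C →
             φ ⊢₁ (compl l ∷ D) → All (_≡ compl l) D →
             φ ⊢₁ remove l C

URC : ∀ {n} → CNF n → Set
URC φ = ∀ α → PartialAssignment α → Unsat (φ ∧ₚ α) → (φ ∧ₚ α) ⊢₁ []

-- ψ_n for n = suc m (indices 0-based: i ↦ i+1 for i < m; last index fromℕ m)
ψ : (m : ℕ) → CNF (suc m)
ψ m = concatMap chain (allFin m) ++ last
  where
  chain : Fin m → List (Clause (suc m))
  chain i =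
      (neg (a (inject₁ i)) ∷ neg (x (inject₁ i)) ∷ pos (x (suc i)) ∷ [])
    ∷ (neg (a (inject₁ i)) ∷ pos (x (inject₁ i)) ∷ neg (x (suc i)) ∷ [])
    ∷ (neg (b (inject₁ i)) ∷ neg (x (inject₁ i)) ∷ pos (x (suc i)) ∷ [])
    ∷ (neg (b (inject₁ i)) ∷ pos (x (inject₁ i)) ∷ neg (x (suc i)) ∷ [])
    ∷ []
  last : List (Clause (suc m))
  last =
      (neg (a (fromℕ m)) ∷ neg (x zero) ∷ neg (x (fromℕ m)) ∷ [])
    ∷ (neg (a (fromℕ m)) ∷ pos (x zero) ∷ pos (x (fromℕ m)) ∷ [])
    ∷ (neg (b (fromℕ m)) ∷ neg (x zero) ∷ neg (x (fromℕ m)) ∷ [])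
    ∷ (neg (b (fromℕ m)) ∷ pos (x zero) ∷ pos (x (fromℕ m)) ∷ [])
    ∷ []

-- For c ∈ {0,1}ⁿ let α_c set a_i := c_i and b_i := ¬c_i. Every guard a_i ∨ b_i then
-- holds, so ψ ∧ α_c forces the odd cycle x_1 ⇔ … ⇔ x_n ⇔ ¬x_1 and is unsatisfiable;
-- by URC unit resolution refutes φ ∧ α_c. Unit resolution starting from α_c can only
-- use a clause of φ that α_c falsifies except for (copies of) one literal x_k^s, so φ
-- has such a clause C_c. If C_c = C_d with c_j ≠ d_j, switch both guards at j off, keep
-- α_c elsewhere, and assign x consistently along the path obtained by cutting the
-- cycle at j, with x_k^s false: this satisfies ψ, hence φ, but falsifies C_c.
-- Thus c ↦ C_c is injective and |φ| ≥ 2ⁿ.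
module Submission where

open import Defs
open import Data.Nat using (ℕ; suc; _^_; _≤_)
open import Data.List using (length)

open import Data.Bool using (Bool; true; false; not; T; _∧_; _∨_; _xor_)
import Data.Bool as Bool
open import Data.Bool.Properties
  using (T-∨; not-involutive; not-injective; not-¬; not-distribˡ-xor; xor-same; ∧-zeroʳ)
open import Data.Empty using (⊥; ⊥-elim)
open import Data.Fin using (Fin; zero; suc; inject₁; fromℕ; finToFun; funToFin; combine)
import Data.Fin as Fin
open import Data.Fin.Properties using (2↔Bool; funToFin-finToFin; injective⇒≤)
open import Data.List using (List; []; _∷_; _++_; map; concatMap; allFin; lookup)
open import Data.List.Membership.Propositional using (_∈_)
open import Data.List.Membership.Propositional.Properties
  using (∈-++⁺ˡ; ∈-++⁺ʳ; ∈-++⁻; ∈-map⁺; ∈-map⁻; ∈-filter⁺; ∈-allFin; ∈-lookup)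
open import Data.List.Relation.Unary.All as All using (All; []; _∷_)
open import Data.List.Relation.Unary.All.Properties
  using (all⁺; all⁻; ++⁺; ++⁻; concat⁺; concat⁻; map⁺; map⁻; tabulate⁺)
open import Data.List.Relation.Unary.Any using (Any; here; there; index)
open import Data.List.Relation.Unary.Any.Properties using (any⁻; lookup-index)
open import Data.Maybe using (Maybe; just; nothing)
import Data.Maybe as Maybe
open import Data.Maybe.Properties using (just-injective)
open import Data.Product using (Σ-syntax; _×_; _,_)
open import Data.Sum using (_⊎_; inj₁; inj₂)
open import Function using (_∘_; _⇔_; mk⇔; Equivalence; Inverse)
open import Relation.Binary.PropositionalEquality
  using (_≡_; _≢_; _≗_; refl; sym; trans; cong; cong₂; subst; module ≡-Reasoning)
open import Relation.Nullary using (does; yes; no; ¬_; ¬?; contradiction)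
open import Relation.Nullary.Decidable using (dec-true; dec-false)

private
  variable
    n m : ℕ

lit : Var n → Bool → Lit n
lit v true  = pos v
lit v false = neg v

compl-involutive : (l : Lit n) → compl (compl l) ≡ l
compl-involutive (pos _) = refl
compl-involutive (neg _) = refl

evalLit-compl : (σ : Var n → Bool) (l : Lit n) → evalLit σ (compl l) ≡ not (evalLit σ l)
evalLit-compl σ (pos v) = refl
evalLit-compl σ (neg v) = sym (not-involutive (σ v))

evalLit-lit-not : (σ : Var n → Bool) (v : Var n) (s : Bool) → σ v ≡ not s → evalLit σ (lit v s) ≡ false
evalLit-lit-not σ v true  e = e
evalLit-lit-not σ v false e = cong not e

¬T⇒≡false : ∀ {p} → ¬ T p → p ≡ false
¬T⇒≡false {false} _ = refl
¬T⇒≡false {true} ¬t = ⊥-elim (¬t _)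

αc : (Fin n → Bool) → List (Lit n)
αc {n} c = map (λ i → lit (a i) (c i)) (allFin n) ++ map (λ i → lit (b i) (not (c i))) (allFin n)

value : (Fin n → Bool) → Lit n → Maybe Bool
value c (pos (x i)) = nothing
value c (neg (x i)) = nothing
value c (pos (a i)) = just (c i)
value c (neg (a i)) = just (not (c i))
value c (pos (b i)) = just (not (c i))
value c (neg (b i)) = just (c i)

value-compl : (c : Fin n → Bool) (l : Lit n) → value c (compl l) ≡ Maybe.map not (value c l)
value-compl c (pos (x i)) = refl
value-compl c (neg (x i)) = refl
value-compl c (pos (a i)) = refl
value-compl c (neg (a i)) = cong just (sym (not-involutive (c i)))
value-compl c (pos (b i)) = cong just (sym (not-involutive (c i)))
value-compl c (neg (b i)) = refl

value-compl-true : (c : Fin n → Bool) (l : Lit n) →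
  value c (compl l) ≡ just true → value c l ≡ just false
value-compl-true c l e = begin
  value c l                      ≡⟨ cong (value c) (sym (compl-involutive l)) ⟩
  value c (compl (compl l))      ≡⟨ value-compl c (compl l) ⟩
  Maybe.map not (value c (compl l)) ≡⟨ cong (Maybe.map not) e ⟩
  just false                     ∎
  where open ≡-Reasoning

value-x : (c : Fin n → Bool) (k : Fin n) (s : Bool) → value c (lit (x k) s) ≡ nothing
value-x c k true  = refl
value-x c k false = refl

unassigned⇒x : (c : Fin n → Bool) (l : Lit n) → value c l ≡ nothing →
  Σ[ k ∈ Fin n ] Σ[ s ∈ Bool ] l ≡ lit (x k) s
unassigned⇒x c (pos (x i)) _ = i , true , refl
unassigned⇒x c (neg (x i)) _ = i , false , refl

value-αc : (c : Fin n → Bool) {l : Lit n} → l ∈ αc c → value c l ≡ just true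
value-αc {n} c mem with ∈-++⁻ (map (λ i → lit (a i) (c i)) (allFin n)) mem
... | inj₁ mem-a with i , _ , refl ← ∈-map⁻ _ mem-a = value-a i
  where
  value-a : ∀ i → value c (lit (a i) (c i)) ≡ just true
  value-a i with c i in e
  ... | true  = cong just e
  ... | false = cong (just ∘ not) e
... | inj₂ mem-b with i , _ , refl ← ∈-map⁻ _ mem-b = value-b i
  where
  value-b : ∀ i → value c (lit (b i) (not (c i))) ≡ just true
  value-b i with c i in e
  ... | true  = cong just e
  ... | false = cong (just ∘ not) e

αc-partial : (c : Fin n → Bool) → PartialAssignment (αc c)
αc-partial c {l} mem mem′
  with () ← trans (sym (value-compl-true c l (value-αc c mem′))) (value-αc c mem)

-- Clauses on which unit propagation from α_c has no effect.
data Inert (c : Fin n → Bool) (C : Clause n) : Set where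
  satisfied  : ∀ {l} → l ∈ C → value c l ≡ just true → Inert c C
  undecided  : ∀ {l l′} → l ∈ C → l′ ∈ C → value c l ≡ nothing → value c l′ ≡ nothing →
               l ≢ l′ → Inert c C

FalseOr : (Fin n → Bool) → Lit n → Lit n → Set
FalseOr c l₀ l = value c l ≡ just false ⊎ l ≡ l₀

Forcing : (Fin n → Bool) → Clause n → Set
Forcing {n} c C = Σ[ k ∈ Fin n ] Σ[ s ∈ Bool ] All (FalseOr c (lit (x k) s)) C

inert-∷ : {c : Fin n → Bool} {l : Lit n} {C : Clause n} → Inert c C → Inert c (l ∷ C)
inert-∷ (satisfied p e)             = satisfied (there p) e
inert-∷ (undecided p p′ e e′ l≢l′) = undecided (there p) (there p′) e e′ l≢l′

¬inert-[] : {c : Fin n → Bool} → ¬ Inert c []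
¬inert-[] (satisfied () _)
¬inert-[] (undecided () _ _ _ _)

∈-unit : {l l′ : Lit n} {D : Clause n} → All (_≡ l) D → l′ ∈ l ∷ D → l′ ≡ l
∈-unit _    (here e)  = e
∈-unit D≡l (there p) = All.lookup D≡l p

inert-unit : {c : Fin n → Bool} {l : Lit n} {D : Clause n} →
  All (_≡ l) D → Inert c (l ∷ D) → value c l ≡ just true
inert-unit D≡l (satisfied p e) = subst (λ l → value _ l ≡ just true) (∈-unit D≡l p) e
inert-unit D≡l (undecided p p′ _ _ l≢l′) = contradiction (trans (∈-unit D≡l p) (sym (∈-unit D≡l p′))) l≢l′

∈-remove : {l l′ : Lit n} {C : Clause n} → l′ ∈ C → l′ ≢ l → l′ ∈ remove l C
∈-remove {l = l} p l′≢l = ∈-filter⁺ (λ l′ → ¬? (l′ ≟L l)) p l′≢l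

inert-remove : {c : Fin n → Bool} {l : Lit n} {C : Clause n} →
  value c l ≡ just false → Inert c C → Inert c (remove l C)
inert-remove l-false (satisfied p e) =
  satisfied (∈-remove p λ { refl → contradiction (trans (sym e) l-false) λ () }) e
inert-remove l-false (undecided p p′ e e′ l≢l′) =
  undecided (∈-remove p λ { refl → contradiction (trans (sym e) l-false) λ () })
            (∈-remove p′ λ { refl → contradiction (trans (sym e′) l-false) λ () })
            e e′ l≢l′

inert-closed : {c : Fin n → Bool} {φ : CNF n} {α : List (Lit n)} →
  (∀ {C} → C ∈ φ → Inert c C) → (∀ {l} → l ∈ α → value c l ≡ just true) →
  ∀ {D} → (φ ∧ₚ α) ⊢₁ D → Inert c D
inert-closed {φ = φ} inert-φ true-α (axiom mem) with ∈-++⁻ φ mem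
... | inj₁ mem-φ = inert-φ mem-φ
... | inj₂ mem-α with l , l∈α , refl ← ∈-map⁻ _ mem-α = satisfied (here refl) (true-α l∈α)
inert-closed inert-φ true-α (unit-res {l = l} p _ q D≡l) =
  inert-remove (value-compl-true _ l (inert-unit D≡l (inert-closed inert-φ true-α q)))
               (inert-closed inert-φ true-α p)

data Status (c : Fin n → Bool) (C : Clause n) : Set where
  inert    : Inert c C → Status c C
  conflict : All (λ l → value c l ≡ just false) C → Status c C
  unit     : ∀ k s → lit (x k) s ∈ C → All (FalseOr c (lit (x k) s)) C → Status c C

status : (c : Fin n → Bool) (C : Clause n) → Status c C
status c [] = conflict []
status c (l ∷ C) with value c l in e | status c C
... | just true  | _              = inert (satisfied (here refl) e)
... | just false | inert i        = inert (inert-∷ i)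
... | just false | conflict fs    = conflict (e ∷ fs)
... | just false | unit k s p fs  = unit k s (there p) (inj₁ e ∷ fs)
... | nothing    | inert i        = inert (inert-∷ i)
... | nothing    | conflict fs with k , s , refl ← unassigned⇒x c l e =
  unit k s (here refl) (inj₂ refl ∷ All.map inj₁ fs)
... | nothing    | unit k s p fs with l ≟L lit (x k) s
...   | yes l≡xₖ = unit k s (there p) (inj₂ l≡xₖ ∷ fs)
...   | no  l≢xₖ = inert (undecided (here refl) (there p) e (value-x c k s) l≢xₖ)

inert⊎forcing : (c : Fin (suc n) → Bool) (C : Clause (suc n)) → Inert c C ⊎ Forcing c C
inert⊎forcing c C with status c C
... | inert i        = inj₁ i
... | conflict fs    = inj₂ (zero , true , All.map inj₁ fs)
... | unit k s _ fs  = inj₂ (k , s , fs)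

infix 4 _⊨_
_⊨_ : (Var n → Bool) → CNF n → Set
σ ⊨ φ = All (T ∘ evalClause σ) φ

⊨⇔T : (σ : Var n → Bool) (φ : CNF n) → σ ⊨ φ ⇔ T (evalCNF σ φ)
⊨⇔T σ φ = mk⇔ (all⁻ (evalClause σ)) (all⁺ (evalClause σ) φ)

⊨-equivalent : {φ φ′ : CNF n} → Equivalent φ φ′ → (σ : Var n → Bool) → σ ⊨ φ → σ ⊨ φ′
⊨-equivalent {φ = φ} {φ′} eqv σ sat =
  Equivalence.from (⊨⇔T σ φ′) (subst T (eqv σ) (Equivalence.to (⊨⇔T σ φ) sat))

⊨-∧ₚ⁻ : (σ : Var n → Bool) (φ : CNF n) (α : List (Lit n)) →
  σ ⊨ (φ ∧ₚ α) → σ ⊨ φ × All (T ∘ evalLit σ) α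
⊨-∧ₚ⁻ σ φ α sat with sat-φ , sat-α ← ++⁻ φ sat =
  sat-φ , All.map (λ {l} → unit-true {l}) (map⁻ {P = T ∘ evalClause σ} {f = λ l → l ∷ []} sat-α)
  where
  unit-true : ∀ {l} → T (evalClause σ (l ∷ [])) → T (evalLit σ l)
  unit-true {l} t with here t′ ← any⁻ (evalLit σ) (l ∷ []) t = t′

All-concatMap-allFin : {A : Set} {P : A → Set} (f : Fin n → List A) →
  All P (concatMap f (allFin n)) ⇔ (∀ i → All P (f i))
All-concatMap-allFin f = mk⇔
  (λ all-P i → All.lookup (map⁻ (concat⁻ all-P)) (∈-allFin i))
  (λ all-P → concat⁺ (map⁺ (tabulate⁺ all-P)))

guardedIff : Var n → Lit n → Lit n → List (Clause n)
guardedIff g p q = (neg g ∷ compl p ∷ q ∷ []) ∷ (neg g ∷ p ∷ compl q ∷ []) ∷ []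

iff-clauses : ∀ {G P P̄ Q Q̄} → P̄ ≡ not P → Q̄ ≡ not Q →
  (T (not G ∨ P̄ ∨ Q ∨ false) × T (not G ∨ P ∨ Q̄ ∨ false)) ⇔ (T G → P ≡ Q)
iff-clauses {G} {P} {_} {Q} refl refl = mk⇔ (λ (t , t′) → to G P Q t t′) (from G P Q)
  where
  to : ∀ G P Q → T (not G ∨ not P ∨ Q ∨ false) → T (not G ∨ P ∨ not Q ∨ false) → T G → P ≡ Q
  to _     true  true  _  _  _ = refl
  to _     false false _  _  _ = refl
  to true  true  false () _  _
  to true  false true  _  () _
  to false _     _     _  _  ()
  from : ∀ G P Q → (T G → P ≡ Q) → T (not G ∨ not P ∨ Q ∨ false) × T (not G ∨ P ∨ not Q ∨ false)
  from false _     _     _ = _ , _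
  from true  true  true  _ = _ , _
  from true  false false _ = _ , _
  from true  true  false h = contradiction (h _) λ ()
  from true  false true  h = contradiction (h _) λ ()

guardedIff-sat : (σ : Var n → Bool) (g : Var n) (p q : Lit n) →
  σ ⊨ guardedIff g p q ⇔ (T (σ g) → evalLit σ p ≡ evalLit σ q)
guardedIff-sat σ g p q = mk⇔
  (λ { (t ∷ t′ ∷ []) → Equivalence.to clauses (t , t′) })
  (λ h → let (t , t′) = Equivalence.from clauses h in t ∷ t′ ∷ [])
  where
  clauses = iff-clauses {G = σ g} (evalLit-compl σ p) (evalLit-compl σ q)

Guard : (Var n → Bool) → Fin n → Set
Guard σ i = T (σ (a i) ∨ σ (b i))

guarded : Fin n → Lit n → Lit n → List (Clause n)
guarded i p q = guardedIff (a i) p q ++ guardedIff (b i) p q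

guarded-sat : (σ : Var n → Bool) (i : Fin n) (p q : Lit n) →
  σ ⊨ guarded i p q ⇔ (Guard σ i → evalLit σ p ≡ evalLit σ q)
guarded-sat σ i p q = mk⇔ to from
  where
  via-a = guardedIff-sat σ (a i) p q
  via-b = guardedIff-sat σ (b i) p q
  to : σ ⊨ guarded i p q → Guard σ i → evalLit σ p ≡ evalLit σ q
  to sat g with sat-a , sat-b ← ++⁻ (guardedIff (a i) p q) sat
              | Equivalence.to (T-∨ {σ (a i)}) g
  ... | inj₁ t = Equivalence.to via-a sat-a t
  ... | inj₂ t = Equivalence.to via-b sat-b t
  from : (Guard σ i → evalLit σ p ≡ evalLit σ q) → σ ⊨ guarded i p q
  from h = ++⁺ (Equivalence.from via-a (h ∘ Equivalence.from T-∨ ∘ inj₁))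
               (Equivalence.from via-b (h ∘ Equivalence.from (T-∨ {σ (a i)}) ∘ inj₂))

link : (m : ℕ) → Fin m → List (Clause (suc m))
link m i = guarded (inject₁ i) (pos (x (inject₁ i))) (pos (x (suc i)))

CycleLinks : (m : ℕ) → (Var (suc m) → Bool) → Set
CycleLinks m σ =
  (∀ i → Guard σ (inject₁ i) → σ (x (inject₁ i)) ≡ σ (x (suc i))) ×
  (Guard σ (fromℕ m) → σ (x zero) ≡ not (σ (x (fromℕ m))))

ψ-sat : (m : ℕ) (σ : Var (suc m) → Bool) → σ ⊨ ψ m ⇔ CycleLinks m σ
ψ-sat m σ = mk⇔ to from
  where
  links = All-concatMap-allFin {P = T ∘ evalClause σ} (link m)
  to : σ ⊨ ψ m → CycleLinks m σ
  to sat with sat-links , sat-closing ← ++⁻ (concatMap (link m) (allFin m)) sat =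
    (λ i → Equivalence.to (guarded-sat σ _ _ _) (Equivalence.to links sat-links i)) ,
    Equivalence.to (guarded-sat σ _ _ _) sat-closing
  from : CycleLinks m σ → σ ⊨ ψ m
  from (hs , h) = ++⁺ (Equivalence.from links λ i → Equivalence.from (guarded-sat σ _ _ _) (hs i))
                      (Equivalence.from (guarded-sat σ _ _ _) h)

path-≡ : {A : Set} (f : Fin (suc m) → A) →
  (∀ i → f (inject₁ i) ≡ f (suc i)) → f zero ≡ f (fromℕ m)
path-≡ {m = ℕ.zero}  f _    = refl
path-≡ {m = suc m}   f step = trans (path-≡ (f ∘ inject₁) (step ∘ inject₁)) (step (fromℕ m))

ψ-unsat-guarded : (σ : Var (suc m) → Bool) → (∀ i → Guard σ i) → ¬ σ ⊨ ψ m
ψ-unsat-guarded {m} σ guards sat with steps , closed ← Equivalence.to (ψ-sat m σ) sat =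
  not-¬ (path-≡ (σ ∘ x) λ i → steps i (guards (inject₁ i))) (closed (guards (fromℕ m)))

αc-guards : (σ : Var n → Bool) (c : Fin n → Bool) →
  All (T ∘ evalLit σ) (αc c) → ∀ i → Guard σ i
αc-guards {n} σ c sat i =
  forced (c i) (All.lookup sat (∈-++⁺ˡ (∈-map⁺ _ (∈-allFin i))))
               (All.lookup sat (∈-++⁺ʳ (map (λ i → lit (a i) (c i)) (allFin n)) (∈-map⁺ _ (∈-allFin i))))
  where
  forced : ∀ t → T (evalLit σ (lit (a i) t)) → T (evalLit σ (lit (b i) (not t))) → Guard σ i
  forced true  t _ = Equivalence.from T-∨ (inj₁ t)
  forced false _ t = Equivalence.from (T-∨ {σ (a i)}) (inj₂ t)

αc-refutes : {φ : CNF (suc m)} → Equivalent φ (ψ m) → (c : Fin (suc m) → Bool) → Unsat (φ ∧ₚ αc c)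
αc-refutes {φ = φ} eqv c σ = ¬T⇒≡false λ t →
  let sat-φ , sat-α = ⊨-∧ₚ⁻ σ φ (αc c) (Equivalence.from (⊨⇔T σ (φ ∧ₚ αc c)) t)
  in  ψ-unsat-guarded σ (αc-guards σ c sat-α) (⊨-equivalent eqv σ sat-φ)

forcing-clause : {φ : CNF (suc m)} → URC φ → Equivalent φ (ψ m) →
  (c : Fin (suc m) → Bool) → Any (Forcing c) φ
forcing-clause {φ = φ} urc eqv c with All.decide (inert⊎forcing c) φ
... | inj₂ forcing = forcing
... | inj₁ inert-φ = ⊥-elim (¬inert-[] (inert-closed {φ = φ} {α = αc c} (All.lookup inert-φ) (value-αc c)
                      (urc (αc c) (αc-partial c) (αc-refutes {φ = φ} eqv c))))

_≤ᵇ_ : Fin n → Fin n → Bool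
zero  ≤ᵇ _     = true
suc i ≤ᵇ zero  = false
suc i ≤ᵇ suc j = i ≤ᵇ j

≤ᵇ-inject₁-suc : (i : Fin m) (j : Fin (suc m)) → inject₁ i ≢ j → (inject₁ i ≤ᵇ j) ≡ (suc i ≤ᵇ j)
≤ᵇ-inject₁-suc zero    zero    i≢j = contradiction refl i≢j
≤ᵇ-inject₁-suc zero    (suc j) _   = refl
≤ᵇ-inject₁-suc (suc i) zero    _   = refl
≤ᵇ-inject₁-suc (suc i) (suc j) i≢j = ≤ᵇ-inject₁-suc i j (i≢j ∘ cong suc)

fromℕ-≰ᵇ : (m : ℕ) (j : Fin (suc m)) → j ≢ fromℕ m → (fromℕ m ≤ᵇ j) ≡ false
fromℕ-≰ᵇ ℕ.zero  zero    j≢m = contradiction refl j≢m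
fromℕ-≰ᵇ (suc m) zero    _   = refl
fromℕ-≰ᵇ (suc m) (suc j) j≢m = fromℕ-≰ᵇ m j (j≢m ∘ cong suc)

-- α_c with both guards at j switched off; x flips exactly across the cut between
-- x_j and x_{j+1}, normalised so that x_k^s is false.
cut : (Fin n → Bool) → (j k : Fin n) → Bool → Var n → Bool
cut c j k s (x i) = ((i ≤ᵇ j) xor (k ≤ᵇ j)) xor not s
cut c j k s (a i) = not (does (i Fin.≟ j)) ∧ c i
cut c j k s (b i) = not (does (i Fin.≟ j)) ∧ not (c i)

module _ (c : Fin n → Bool) (j k : Fin n) (s : Bool) where

  private
    σ = cut c j k s

  cut-guard : ∀ {i} → Guard σ i → i ≢ j
  cut-guard {i} g i≡j = subst T (cong₂ _∨_ (off (c i)) (off (not (c i)))) g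
    where
    off : ∀ t → not (does (i Fin.≟ j)) ∧ t ≡ false
    off t = cong (λ d → not d ∧ t) (dec-true (i Fin.≟ j) i≡j)

  cut-x : evalLit σ (lit (x k) s) ≡ false
  cut-x = evalLit-lit-not σ (x k) s (cong (_xor not s) (xor-same (k ≤ᵇ j)))

  cut-assigned : ∀ (d : Fin n → Bool) → c j ≢ d j → (l : Lit n) →
    value c l ≡ just false → value d l ≡ just false → evalLit σ l ≡ false
  cut-assigned d cj≢dj (pos (a i)) e _ = trans (cong (_ ∧_) (just-injective e)) (∧-zeroʳ _)
  cut-assigned d cj≢dj (pos (b i)) e _ = trans (cong (_ ∧_) (just-injective e)) (∧-zeroʳ _)
  cut-assigned d cj≢dj (neg (a i)) e e′ = begin
    not (not (does (i Fin.≟ j)) ∧ c i) ≡⟨ cong (λ t → not (not t ∧ c i)) (dec-false (i Fin.≟ j) i≢j) ⟩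
    not (c i)                          ≡⟨ just-injective e ⟩
    false                              ∎
    where
    open ≡-Reasoning
    i≢j : i ≢ j
    i≢j refl = cj≢dj (trans (not-injective (just-injective e)) (sym (not-injective (just-injective e′))))
  cut-assigned d cj≢dj (neg (b i)) e e′ = begin
    not (not (does (i Fin.≟ j)) ∧ not (c i)) ≡⟨ cong (λ t → not (not t ∧ not (c i))) (dec-false (i Fin.≟ j) i≢j) ⟩
    not (not (c i))                          ≡⟨ not-involutive (c i) ⟩
    c i                                      ≡⟨ just-injective e ⟩
    false                                    ∎
    where
    open ≡-Reasoning
    i≢j : i ≢ j
    i≢j refl = cj≢dj (trans (just-injective e) (sym (just-injective e′)))

  cut-falsifies : ∀ (d : Fin n → Bool) k′ s′ → c j ≢ d j → (l : Lit n) →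
    FalseOr c (lit (x k) s) l → FalseOr d (lit (x k′) s′) l → evalLit σ l ≡ false
  cut-falsifies d k′ s′ _     l (inj₂ refl) _            = cut-x
  cut-falsifies d k′ s′ _     l (inj₁ e)    (inj₂ refl)  = contradiction (trans (sym (value-x c k′ s′)) e) λ ()
  cut-falsifies d k′ s′ cj≢dj l (inj₁ e)    (inj₁ e′)    = cut-assigned d cj≢dj l e e′

cut-⊨ψ : (c : Fin (suc m) → Bool) (j k : Fin (suc m)) (s : Bool) → cut c j k s ⊨ ψ m
cut-⊨ψ {m} c j k s = Equivalence.from (ψ-sat m σ) (step , closed)
  where
  σ = cut c j k s
  step : ∀ i → Guard σ (inject₁ i) → σ (x (inject₁ i)) ≡ σ (x (suc i))
  step i g = cong (λ t → (t xor (k ≤ᵇ j)) xor not s) (≤ᵇ-inject₁-suc i j (cut-guard c j k s g))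
  closed : Guard σ (fromℕ m) → σ (x zero) ≡ not (σ (x (fromℕ m)))
  closed g = begin
    not (k ≤ᵇ j) xor not s                      ≡⟨ sym (not-distribˡ-xor (k ≤ᵇ j) (not s)) ⟩
    not ((k ≤ᵇ j) xor not s)                    ≡⟨ cong (λ t → not ((t xor (k ≤ᵇ j)) xor not s)) (sym j≰m) ⟩
    not (((fromℕ m ≤ᵇ j) xor (k ≤ᵇ j)) xor not s) ∎
    where
    open ≡-Reasoning
    j≰m = fromℕ-≰ᵇ m j (cut-guard c j k s g ∘ sym)

forcing-unique : {φ : CNF (suc m)} → Equivalent φ (ψ m) →
  ∀ {C} → C ∈ φ → (c d : Fin (suc m) → Bool) → Forcing c C → Forcing d C → c ≗ d
forcing-unique {m} eqv {C} C∈φ c d (k , s , fc) (k′ , s′ , fd) j with c j Bool.≟ d j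
... | yes cj≡dj = cj≡dj
... | no  cj≢dj = ⊥-elim (falsified-satisfied
        (All.zipWith (λ (p , q) → cut-falsifies c j k s d k′ s′ cj≢dj _ p q) (fc , fd))
        (All.lookup (⊨-equivalent (sym ∘ eqv) σ (cut-⊨ψ c j k s)) C∈φ))
  where
  σ = cut c j k s
  falsified-satisfied : All (λ l → evalLit σ l ≡ false) C → ¬ T (evalClause σ C)
  falsified-satisfied falsified sat
    with l-false , l-true ← All.lookupAny falsified (any⁻ (evalLit σ) C sat) = subst T l-false l-true

funToFin-cong : (f g : Fin n → Fin m) → f ≗ g → funToFin f ≡ funToFin g
funToFin-cong {ℕ.zero}  f g f≗g = refl
funToFin-cong {suc n}   f g f≗g = cong₂ combine (f≗g zero) (funToFin-cong (f ∘ suc) (g ∘ suc) (f≗g ∘ suc))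

injective⇒2^n≤ : ∀ {k} (f : (Fin n → Bool) → Fin k) → (∀ c d → f c ≡ f d → c ≗ d) → 2 ^ n ≤ k
injective⇒2^n≤ {n} f f-inj = injective⇒≤ {f = f ∘ bits} λ {i} {i′} e → begin
  i                        ≡⟨ sym (funToFin-finToFin {n} {2} i) ⟩
  funToFin (digitsOf i)    ≡⟨ funToFin-cong (digitsOf i) (digitsOf i′) (digits (f-inj _ _ e)) ⟩
  funToFin (digitsOf i′)   ≡⟨ funToFin-finToFin {n} {2} i′ ⟩
  i′                       ∎
  where
  open ≡-Reasoning
  open Inverse 2↔Bool using (to; strictlyInverseʳ)
  digitsOf : Fin (2 ^ n) → Fin n → Fin 2
  digitsOf = finToFun
  bits : Fin (2 ^ n) → Fin n → Bool
  bits i = to ∘ digitsOf i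
  digits : ∀ {i i′} → bits i ≗ bits i′ → digitsOf i ≗ digitsOf i′
  digits {i} {i′} e t = begin
    digitsOf i t                       ≡⟨ sym (strictlyInverseʳ _) ⟩
    Inverse.from 2↔Bool (bits i t)     ≡⟨ cong (Inverse.from 2↔Bool) (e t) ⟩
    Inverse.from 2↔Bool (bits i′ t)    ≡⟨ strictlyInverseʳ _ ⟩
    digitsOf i′ t                      ∎

proposition3 : (m : ℕ) (φ : CNF (suc m)) → URC φ → Equivalent φ (ψ m) →
    2 ^ suc m ≤ length φ
proposition3 m φ urc eqv = injective⇒2^n≤ (index ∘ forcing) λ c d e →
  forcing-unique {φ = φ} eqv (∈-lookup _) c d
    (lookup-index (forcing c))
    (subst (Forcing d ∘ lookup φ) (sym e) (lookup-index (forcing d)))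
  where
  forcing : ∀ c → Any (Forcing c) φ
  forcing = forcing-clause urc eqv
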